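{- For every integer $n \ge 2$ there exists a graceful sequence $0 = x_1 < x_2 < \dots < x_n$ of $n$ integers such that $x_n \le (n-1) + \frac{(n-1)^2(n-2)}{4}$ if $n$ is odd, and $x_n \le (n-1) + \frac{n(n-1)(n-2)}{4}$ if $n$ is even. Equivalently, these quantities are upper bounds for the length of an optimal Golomb ruler with $n$ marks.
   Context: A sequence of integers $0 = x_1 < x_2 < \dots < x_n$ is called a graceful sequence if all pairwise differences are distinct: whenever $|x_i - x_j| = |x_p - x_q|$ with $i \neq j$ and $p \neq q$, we have $\{i,j\} = \{p,q\}$. A Golomb ruler with $n$ marks is such a sequence, its length is $x_n$, and an optimal Golomb ruler is one of minimum length $x_n$ for the given $n$. -}

module Defs where

open import Data.Nat using (ℕ; zero; suc; _+_; _*_; _∸_; _<_; _≤_; ∣_-_∣)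
open import Data.Fin using (Fin; zero; suc; _<_) renaming (toℕ to toℕ)
open import Data.Product using (_×_)
open import Data.Sum using (_⊎_)
open import Relation.Binary.PropositionalEquality using (_≡_; _≢_)

-- A finite sequence x_1,...,x_n, indexed by Fin n (index 0 is x_1).
-- Since x_1 = 0 and the sequence is strictly increasing, all terms are
-- non-negative, so we take values in ℕ.

StrictlyIncreasing : {n : ℕ} → (Fin n → ℕ) → Set
StrictlyIncreasing {n} x = (i j : Fin n) → i Data.Fin.< j → x i Data.Nat.< x j

Graceful : {n : ℕ} → (Fin n → ℕ) → Set
Graceful {n} x = (i j p q : Fin n) → i ≢ j → p ≢ q →
  ∣ x i - x j ∣ ≡ ∣ x p - x q ∣ →
  ((i ≡ p) × (j ≡ q)) ⊎ ((i ≡ q) × (j ≡ p))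

GracefulSequence : (k : ℕ) → (Fin (suc k) → ℕ) → Set
GracefulSequence k x = (x zero ≡ 0) × StrictlyIncreasing x × Graceful x

module Submission where

-- Write n = k + 1, let B be any number with k ≤ 2B, and let
-- T i = i(i-1)/2 be the triangular numbers.  The marks are
--   x_i = i + T(i)·B          (i = 0, …, k).
-- The marks u and u + a are separated by the gap  a + (a·u + T a)·B.
-- Gaps of equal length a ≥ 1 coincide only for equal starts u.  If a < a'
-- and the gaps coincide, then (a·u + T a)·B exceeds (a'·u' + T a')·B by
-- a' - a < 2B, which forces a' = a + B and a·u + T a = a'·u' + T a' + 1
-- (the "carry" lemma); but the positions fit in [0, 2B], so the left side
-- is at most T(a + B) = T a', a contradiction.  Thus distinct ordered pairs
-- of marks have distinct differences, and the marks form a graceful sequence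
-- for every B with k ≤ 2B.
-- The last mark is k + T(k)·B, i.e. 4 x_k = 4k + k(k-1)·2B; choosing
-- B = ⌈k/2⌉ gives 2B = k for odd n and 2B = k + 1 for even n, which are
-- exactly the two bounds of the theorem.

open import Defs
open import Data.Nat
  using (ℕ; zero; suc; _+_; _*_; _∸_; _≤_; _<_; _%_; ∣_-_∣; ⌊_/2⌋; ⌈_/2⌉; NonZero; s≤s; z<s)
open import Data.Nat.Properties
open import Data.Nat.Tactic.RingSolver using (solve-∀)
open import Data.Fin as Fin using (Fin; toℕ; fromℕ)
open import Data.Fin.Properties using (toℕ-injective; toℕ-fromℕ; toℕ<n)
open import Data.Product using (Σ; ∃; _×_; _,_; proj₁; proj₂)
open import Data.Sum using (_⊎_; inj₁; inj₂)
open import Data.Empty using (⊥-elim)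
open import Relation.Nullary using (contradiction)
open import Relation.Binary.Definitions using (tri<; tri≈; tri>)
open import Relation.Binary.PropositionalEquality

T : ℕ → ℕ
T zero    = 0
T (suc i) = T i + i

T-+ : ∀ a b → T (a + b) ≡ T a + T b + a * b
T-+ zero    b = sym (+-identityʳ (T b))
T-+ (suc a) b = trans (cong (_+ (a + b)) (T-+ a b)) (regroup (T a) (T b) a b)
  where
  regroup : ∀ ta tb a b → ta + tb + a * b + (a + b) ≡ ta + a + tb + (b + a * b)
  regroup = solve-∀

twice-T : ∀ k → 2 * T k ≡ k * (k ∸ 1)
twice-T zero          = refl
twice-T (suc zero)    = refl
twice-T (suc (suc m)) = begin
  2 * (T m + m + suc m)         ≡⟨ distribute (T m) m ⟩
  2 * (T m + m) + 2 * suc m     ≡⟨ cong (_+ 2 * suc m) (twice-T (suc m)) ⟩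
  suc m * m + 2 * suc m         ≡⟨ step m ⟩
  suc (suc m) * suc m           ∎
  where
  open ≡-Reasoning
  distribute : ∀ t m → 2 * (t + m + suc m) ≡ 2 * (t + m) + 2 * suc m
  distribute = solve-∀
  step : ∀ m → suc m * m + 2 * suc m ≡ suc (suc m) * suc m
  step = solve-∀

mark : ℕ → ℕ → ℕ
mark B i = i + T i * B

gap : ℕ → ℕ → ℕ → ℕ
gap B u a = a + (a * u + T a) * B

mark-+ : ∀ B u a → mark B (u + a) ≡ mark B u + gap B u a
mark-+ B u a = trans (cong (λ t → u + a + t * B) (T-+ u a)) (regroup (T u) (T a) u a B)
  where
  regroup : ∀ tu ta u a B → u + a + (tu + ta + u * a) * B ≡ u + tu * B + (a + (a * u + ta) * B)
  regroup = solve-∀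

mark-distance : ∀ B u a → ∣ mark B u - mark B (u + a) ∣ ≡ gap B u a
mark-distance B u a = trans (cong (λ m → ∣ mark B u - m ∣) (mark-+ B u a)) (∣m-m+n∣≡n (mark B u) (gap B u a))

carry : ∀ B P Q e → P * B ≡ suc e + Q * B → suc e < B + B → suc e ≡ B × P ≡ suc Q
carry B P Q e eq e<2B with ≤-<-connex P Q
... | inj₁ P≤Q = ⊥-elim (<-irrefl refl (begin-strict
  P * B          ≤⟨ *-monoˡ-≤ B P≤Q ⟩
  Q * B          <⟨ s≤s (m≤n+m (Q * B) e) ⟩
  suc e + Q * B  ≡⟨ sym eq ⟩
  P * B          ∎))
  where open ≤-Reasoning
... | inj₂ Q<P with m≤n⇒∃[o]m+o≡n Q<P
... | r , refl = excess r (+-cancelʳ-≡ (Q * B) (B + r * B) (suc e) (trans (expand Q B r) eq))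
  where
  expand : ∀ Q B r → B + r * B + Q * B ≡ (suc Q + r) * B
  expand = solve-∀
  -- the surplus (1 + r)·B lies below 2B only for r = 0
  excess : ∀ r → B + r * B ≡ suc e → suc e ≡ B × suc Q + r ≡ suc Q
  excess zero    surplus = trans (sym surplus) (+-identityʳ B) , cong suc (+-identityʳ Q)
  excess (suc r) surplus = ⊥-elim (<-irrefl refl (begin-strict
    B + B            ≤⟨ +-monoʳ-≤ B (m≤m+n B (r * B)) ⟩
    B + (B + r * B)  ≡⟨ surplus ⟩
    suc e            <⟨ e<2B ⟩
    B + B            ∎))
    where open ≤-Reasoning

short-gap-coefficient : ∀ a B u → a ≤ B → u + a ≤ B + B → a * u + T a ≤ T (a + B)
short-gap-coefficient a B u a≤B fits with m≤n⇒∃[o]m+o≡n a≤B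
... | b , refl = begin
  a * u + T a                              ≤⟨ +-monoˡ-≤ (T a) (*-monoʳ-≤ a u≤) ⟩
  a * (a + (b + b)) + T a                  ≤⟨ m≤m+n _ (T a + T b) ⟩
  a * (a + (b + b)) + T a + (T a + T b)    ≡⟨ regroup a b (T a) (T b) ⟩
  T a + (T a + T b + a * b) + a * (a + b)  ≡⟨ cong (λ t → T a + t + a * (a + b)) (sym (T-+ a b)) ⟩
  T a + T (a + b) + a * (a + b)            ≡⟨ sym (T-+ a (a + b)) ⟩
  T (a + (a + b))                          ∎
  where
  open ≤-Reasoning
  u≤ : u ≤ a + (b + b)
  u≤ = +-cancelʳ-≤ a u (a + (b + b)) (subst (u + a ≤_) (double a b) fits)
    where
    double : ∀ a b → (a + b) + (a + b) ≡ a + (b + b) + a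
    double = solve-∀
  regroup : ∀ a b ta tb → a * (a + (b + b)) + ta + (ta + tb) ≡ ta + (ta + tb + a * b) + a * (a + b)
  regroup = solve-∀

longer-gap-differs : ∀ B k u u' a a' → a < a' → u + suc a ≤ k → u' + suc a' ≤ k → k ≤ B + B →
  gap B u (suc a) ≢ gap B u' (suc a')
longer-gap-differs B k u u' a _ a<a' short long k≤2B eq with m≤n⇒∃[o]m+o≡n a<a'
... | e , refl = <-irrefl refl (begin-strict
  Q      <⟨ n<1+n Q ⟩
  suc Q  ≡⟨ sym P≡1+Q ⟩
  P      ≤⟨ P≤T[A'] ⟩
  T A'   ≤⟨ m≤n+m (T A') (A' * u') ⟩
  Q      ∎)
  where
  open ≤-Reasoning
  A  = suc a
  A' = suc (suc a + e)
  P  = A * u + T A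
  Q  = A' * u' + T A'
  -- the longer length is A + (1 + e); removing A from both gaps leaves the excess 1 + e
  A'-split : A' ≡ A + suc e
  A'-split = sym (+-suc A e)
  excess : P * B ≡ suc e + Q * B
  excess = +-cancelˡ-≡ A _ _ (trans eq (trans (cong (_+ Q * B) A'-split) (+-assoc A (suc e) (Q * B))))
  e<2B : suc e < B + B
  e<2B = ≤-trans (s≤s (s≤s (m≤n+m e a))) (≤-trans (m≤n+m A' u') (≤-trans long k≤2B))
  carried : suc e ≡ B × P ≡ suc Q
  carried = carry B P Q e excess e<2B
  P≡1+Q : P ≡ suc Q
  P≡1+Q = proj₂ carried
  A'≡A+B : A' ≡ A + B
  A'≡A+B = trans A'-split (cong (A +_) (proj₁ carried))
  -- A + B = A' ≤ k ≤ 2B, so the shorter length is at most B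
  A≤B : A ≤ B
  A≤B = +-cancelʳ-≤ B A B (≤-trans (subst (_≤ k) A'≡A+B (≤-trans (m≤n+m A' u') long)) k≤2B)
  P≤T[A'] : P ≤ T A'
  P≤T[A'] = subst (λ c → P ≤ T c) (sym A'≡A+B) (short-gap-coefficient A B u A≤B (≤-trans short k≤2B))

room⇒nonZero : ∀ {B k m} → suc m ≤ k → k ≤ B + B → NonZero B
room⇒nonZero {zero}  room k≤0 with ≤-trans room k≤0
... | ()
room⇒nonZero {suc B} _    _   = _

gap-injective : ∀ B k u u' a a' → u + suc a ≤ k → u' + suc a' ≤ k → k ≤ B + B →
  gap B u (suc a) ≡ gap B u' (suc a') → u ≡ u' × a ≡ a'
gap-injective B k u u' a a' fits fits' k≤2B eq with <-cmp a a'
... | tri< a<a' _ _ = ⊥-elim (longer-gap-differs B k u u' a a' a<a' fits fits' k≤2B eq)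
... | tri> _ _ a'<a = ⊥-elim (longer-gap-differs B k u' u a' a a'<a fits' fits k≤2B (sym eq))
... | tri≈ _ refl _ = same-start , refl
  where
  instance
    B≢0 : NonZero B
    B≢0 = room⇒nonZero (≤-trans (m≤n+m (suc a) u) fits) k≤2B
  same-start : u ≡ u'
  same-start = *-cancelˡ-≡ u u' (suc a)
    (+-cancelʳ-≡ (T (suc a)) _ _ (*-cancelʳ-≡ _ _ B (+-cancelˡ-≡ (suc a) _ _ eq)))

≢⇒<⊎> : ∀ {n} {i j : Fin n} → i ≢ j → i Fin.< j ⊎ j Fin.< i
≢⇒<⊎> {i = i} {j} i≢j with Data.Fin.Properties.<-cmp i j
... | tri< i<j _ _ = inj₁ i<j
... | tri≈ _ i≡j _ = contradiction i≡j i≢j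
... | tri> _ _ j<i = inj₂ j<i

graceful-from-ordered : ∀ {n} (x : Fin n → ℕ) →
  (∀ i j p q → i Fin.< j → p Fin.< q → ∣ x i - x j ∣ ≡ ∣ x p - x q ∣ → i ≡ p × j ≡ q) →
  Graceful x
graceful-from-ordered x ordered i j p q i≢j p≢q eq with ≢⇒<⊎> i≢j | ≢⇒<⊎> p≢q
... | inj₁ i<j | inj₁ p<q = inj₁ (ordered i j p q i<j p<q eq)
... | inj₁ i<j | inj₂ q<p with ordered i j q p i<j q<p (trans eq (∣-∣-comm (x p) (x q)))
...   | i≡q , j≡p = inj₂ (i≡q , j≡p)
graceful-from-ordered x ordered i j p q i≢j p≢q eq | inj₂ j<i | inj₁ p<q
  with ordered j i p q j<i p<q (trans (∣-∣-comm (x j) (x i)) eq)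
...   | j≡p , i≡q = inj₂ (i≡q , j≡p)
graceful-from-ordered x ordered i j p q i≢j p≢q eq | inj₂ j<i | inj₂ q<p
  with ordered j i q p j<i q<p (trans (∣-∣-comm (x j) (x i)) (trans eq (∣-∣-comm (x p) (x q))))
...   | j≡q , i≡p = inj₁ (i≡p , j≡q)

ordered-split : ∀ {u v} → u < v → ∃ λ a → v ≡ u + suc a
ordered-split {u} u<v with m≤n⇒∃[o]m+o≡n u<v
... | a , refl = a , sym (+-suc u a)

marks : ℕ → (k : ℕ) → Fin (suc k) → ℕ
marks B k i = mark B (toℕ i)

marks-increasing : ∀ B k → StrictlyIncreasing (marks B k)
marks-increasing B k i j i<j with ordered-split i<j
... | a , j≡ = subst (λ v → mark B (toℕ i) < mark B v) (sym j≡)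
  (subst (mark B (toℕ i) <_) (sym (mark-+ B (toℕ i) (suc a))) (m<m+n (mark B (toℕ i)) z<s))

marks-graceful : ∀ B k → k ≤ B + B → GracefulSequence k (marks B k)
marks-graceful B k k≤2B = refl , marks-increasing B k , graceful-from-ordered (marks B k) distinct
  where
  fits : ∀ {i j : Fin (suc k)} {a} → toℕ j ≡ toℕ i + suc a → toℕ i + suc a ≤ k
  fits {j = j} j≡ = subst (_≤ k) j≡ (≤-pred (toℕ<n j))
  distance : ∀ {i j : Fin (suc k)} {a} → toℕ j ≡ toℕ i + suc a →
    ∣ marks B k i - marks B k j ∣ ≡ gap B (toℕ i) (suc a)
  distance {i} {a = a} j≡ =
    trans (cong (λ v → ∣ mark B (toℕ i) - mark B v ∣) j≡) (mark-distance B (toℕ i) (suc a))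
  distinct : ∀ i j p q → i Fin.< j → p Fin.< q →
    ∣ marks B k i - marks B k j ∣ ≡ ∣ marks B k p - marks B k q ∣ → i ≡ p × j ≡ q
  distinct i j p q i<j p<q eq with ordered-split i<j | ordered-split p<q
  ... | a , j≡ | a' , q≡
    with gap-injective B k (toℕ i) (toℕ p) a a' (fits j≡) (fits q≡) k≤2B
           (trans (sym (distance j≡)) (trans eq (distance q≡)))
  ...   | i≡p , refl =
    toℕ-injective i≡p , toℕ-injective (trans j≡ (trans (cong (_+ suc a) i≡p) (sym q≡)))

last-mark : ∀ B k → 4 * mark B k ≡ 4 * k + k * (k ∸ 1) * (B + B)
last-mark B k = begin
  4 * (k + T k * B)            ≡⟨ regroup k (T k) B ⟩
  4 * k + 2 * T k * (B + B)    ≡⟨ cong (λ t → 4 * k + t * (B + B)) (twice-T k) ⟩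
  4 * k + k * (k ∸ 1) * (B + B) ∎
  where
  open ≡-Reasoning
  regroup : ∀ k t B → 4 * (k + t * B) ≡ 4 * k + 2 * t * (B + B)
  regroup = solve-∀

half-even : ∀ n → n % 2 ≡ 0 → ⌊ n /2⌋ + ⌊ n /2⌋ ≡ n
half-even zero          _    = refl
half-even (suc (suc n)) even = cong suc (trans (+-suc ⌊ n /2⌋ ⌊ n /2⌋) (cong suc (half-even n even)))

half-odd : ∀ n → n % 2 ≡ 1 → suc (⌊ n /2⌋ + ⌊ n /2⌋) ≡ n
half-odd (suc zero)    _   = refl
half-odd (suc (suc n)) odd = cong suc (trans (cong suc (+-suc ⌊ n /2⌋ ⌊ n /2⌋)) (cong suc (half-odd n odd)))

k≤2⌈k/2⌉ : ∀ k → k ≤ ⌈ k /2⌉ + ⌈ k /2⌉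
k≤2⌈k/2⌉ k = subst (_≤ ⌈ k /2⌉ + ⌈ k /2⌉) (⌊n/2⌋+⌈n/2⌉≡n k) (+-monoˡ-≤ ⌈ k /2⌉ (⌊n/2⌋≤⌈n/2⌉ k))

theorem2 : (k : ℕ) → 2 ≤ suc k →
    Σ (Fin (suc k) → ℕ) λ x → GracefulSequence k x ×
      ((suc k % 2 ≡ 1 → 4 * x (fromℕ k) ≤ 4 * k + k * k * (k ∸ 1)) ×
       (suc k % 2 ≡ 0 → 4 * x (fromℕ k) ≤ 4 * k + suc k * k * (k ∸ 1)))
theorem2 k _ = marks B k , marks-graceful B k (k≤2⌈k/2⌉ k) , odd-bound , even-bound
  where
  B = ⌈ k /2⌉
  length : 4 * marks B k (fromℕ k) ≡ 4 * k + k * (k ∸ 1) * (B + B)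
  length = trans (cong (λ i → 4 * mark B i) (toℕ-fromℕ k)) (last-mark B k)
  odd-bound : suc k % 2 ≡ 1 → 4 * marks B k (fromℕ k) ≤ 4 * k + k * k * (k ∸ 1)
  odd-bound odd = ≤-reflexive (trans length (cong (4 * k +_)
    (trans (cong (k * (k ∸ 1) *_) (suc-injective (half-odd (suc k) odd))) (reorder k (k ∸ 1)))))
    where
    reorder : ∀ a b → a * b * a ≡ a * a * b
    reorder = solve-∀
  even-bound : suc k % 2 ≡ 0 → 4 * marks B k (fromℕ k) ≤ 4 * k + suc k * k * (k ∸ 1)
  even-bound even = ≤-reflexive (trans length (cong (4 * k +_)
    (trans (cong (k * (k ∸ 1) *_) (half-even (suc k) even)) (reorder k (k ∸ 1)))))
    where
    reorder : ∀ a b → a * b * suc a ≡ suc a * a * b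
    reorder = solve-∀
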